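{- Let $\phi$ be an unsatisfiable $r$-CNF formula. Then $\mathrm{Space}(\phi)\ge \mathrm{Deg}(\phi)-r-1$, where $\mathrm{Space}$ is $\mathrm{Res}(\oplus)$ space and $\mathrm{Deg}$ is the Polynomial Calculus degree over $\mathbb{F}_2$.
   Context: An $r$-CNF has clauses of at most $r$ literals; it is viewed as a linear CNF by writing $x$ as $(x=1)$, $\neg x$ as $(x=0)$. Linear clauses are disjunctions of equations $f=\alpha$ ($f$ a linear form over $\mathbb{F}_2$, $\alpha\in\{0,1\}$). $\mathrm{Res}(\oplus)$ rules: from $A\lor(f=0)$ and $B\lor(f=1)$ derive $A\lor B$; from $C$ derive any linear clause semantically implied by $C$. A refutation is a sequence of configurations (sets of linear clauses) $S_1=\emptyset,\dots,S_m$ with $S_m$ containing the empty clause, each obtained from the previous by download (add a clause of $\phi$), erasure, or inference (add a clause derived by the rules from the current clauses); space is $\max_i|S_i|$ and $\mathrm{Space}(\phi)$ is the minimum over refutations. Polynomial Calculus over $\mathbb{F}_2$ works with polynomials over $\mathbb{F}_2$; from a set $\mathcal{P}$ it can derive axioms from $\mathcal{P}$ and $x^2-x$ for variables $x$, $\alpha p+\beta q$ from $p,q$, and $xp$ from $p$; a refutation derives the constant $1$; its degree is the maximum degree of a polynomial in it. A clause is arithmetized by the standard translation (the clause $\bigvee_{i\in P}x_i\lor\bigvee_{j\in N}\neg x_j$ becomes $\prod_{i\in P}(1-x_i)\prod_{j\in N}x_j$), and $\mathrm{Deg}(\phi)$ is the minimum degree of a Polynomial Calculus refutation over $\mathbb{F}_2$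 of the arithmetization of $\phi$. -}

module Defs where

open import Data.Nat using (ℕ; _≤_; _+_; _⊔_)
open import Data.Bool using (Bool; true; false; not; _∧_; _xor_; T; if_then_else_)
open import Data.Fin using (Fin)
import Data.Fin as Fin
open import Data.Vec using (Vec; tabulate; zipWith; replicate)
import Data.Vec as Vec
import Data.Vec.Properties as VecP
import Data.Nat.Properties as ℕP
open import Data.List using (List; []; _∷_; _++_; length; map; concatMap; foldr)
open import Data.Bool.ListAction using (any; all)
open import Data.List.Membership.Propositional using (_∈_)
open import Data.List.Relation.Unary.All using (All)
open import Data.List.Relation.Unary.Unique.Propositional using (Unique)
open import Data.List.Relation.Binary.Permutation.Propositional using (_↭_)
open import Data.Product using (_×_; _,_)
open import Relation.Nullary.Decidable using (⌊_⌋)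
open import Relation.Binary.PropositionalEquality using (_≡_)

Assignment : ℕ → Set
Assignment n = Fin n → Bool

-- literal (i , true) is x_i, literal (i , false) is ¬ x_i
Literal : ℕ → Set
Literal n = Fin n × Bool

-- a clause is a (duplicate-free, see IsRCNF) list of literals
Clause : ℕ → Set
Clause n = List (Literal n)

CNF : ℕ → Set
CNF n = List (Clause n)

evalLit : ∀ {n} → Assignment n → Literal n → Bool
evalLit ρ (i , b) = not (ρ i xor b)

evalClause : ∀ {n} → Assignment n → Clause n → Bool
evalClause ρ C = any (evalLit ρ) C

evalCNF : ∀ {n} → Assignment n → CNF n → Bool
evalCNF ρ φ = all (evalClause ρ) φ

Unsatisfiable : ∀ {n} → CNF n → Set
Unsatisfiable {n} φ = (ρ : Assignment n) → evalCNF ρ φ ≡ false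

IsRCNF : ∀ {n} → ℕ → CNF n → Set
IsRCNF r φ = All (λ C → Unique C × length C ≤ r) φ

LinForm : ℕ → Set
LinForm n = Vec Bool n

LinEq : ℕ → Set
LinEq n = LinForm n × Bool

LinClause : ℕ → Set
LinClause n = List (LinEq n)

evalForm : ∀ {n} → Assignment n → LinForm n → Bool
evalForm ρ f = Vec.foldr _ _xor_ false (zipWith _∧_ f (tabulate ρ))

evalEq : ∀ {n} → Assignment n → LinEq n → Bool
evalEq ρ (f , α) = not (evalForm ρ f xor α)

evalLinClause : ∀ {n} → Assignment n → LinClause n → Bool
evalLinClause ρ C = any (evalEq ρ) C

_⊨_ : ∀ {n} → LinClause n → LinClause n → Set
_⊨_ {n} C D = (ρ : Assignment n) → T (evalLinClause ρ C) → T (evalLinClause ρ D)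

_≈ₛ_ : ∀ {n} → LinClause n → LinClause n → Set
C ≈ₛ D = ∀ e → (e ∈ C → e ∈ D) × (e ∈ D → e ∈ C)

unitForm : ∀ {n} → Fin n → LinForm n
unitForm i = tabulate (λ j → ⌊ i Fin.≟ j ⌋)

linLit : ∀ {n} → Literal n → LinEq n
linLit (i , b) = (unitForm i , b)

linClause : ∀ {n} → Clause n → LinClause n
linClause C = map linLit C

Config : ℕ → Set
Config n = List (LinClause n)

data Derivable {n} (S : Config n) (D : LinClause n) : Set where
  resolve : ∀ {C₁ C₂} (f : LinForm n) (A B : LinClause n) →
            C₁ ∈ S → C₂ ∈ S →
            C₁ ≈ₛ ((f , false) ∷ A) → C₂ ≈ₛ ((f , true) ∷ B) →
            D ≈ₛ (A ++ B) → Derivable S D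
  weaken  : ∀ {C} → C ∈ S → C ⊨ D → Derivable S D

data Step {n} (φ : CNF n) (S S′ : Config n) : Set where
  download : ∀ {C} → C ∈ φ → S′ ↭ (linClause C ∷ S) → Step φ S S′
  erase    : ∀ {C} → S ↭ (C ∷ S′) → Step φ S S′
  infer    : ∀ {D} → Derivable S D → S′ ↭ (D ∷ S) → Step φ S S′

data Run {n} (φ : CNF n) : Config n → Set where
  done : ∀ {S} → [] ∈ S → Run φ S
  step : ∀ {S S′} → Step φ S S′ → Run φ S′ → Run φ S

space : ∀ {n} {φ : CNF n} {S : Config n} → Run φ S → ℕ
space {S = S} (done _)   = length S
space {S = S} (step _ r) = length S ⊔ space r

ResXorRefutation : ∀ {n} → CNF n → Set
ResXorRefutation φ = Run φ []

Monomial : ℕ → Set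
Monomial n = Vec ℕ n

-- a polynomial over F_2 is represented by a list of monomials (their sum mod 2)
Poly : ℕ → Set
Poly n = List (Monomial n)

coeff : ∀ {n} → Poly n → Monomial n → Bool
coeff p m = foldr (λ m′ b → if ⌊ VecP.≡-dec ℕP._≟_ m′ m ⌋ then not b else b) false p

monoDeg : ∀ {n} → Monomial n → ℕ
monoDeg m = Vec.sum m

DegLe : ∀ {n} → Poly n → ℕ → Set
DegLe p d = ∀ m → T (coeff p m) → monoDeg m ≤ d

_≈P_ : ∀ {n} → Poly n → Poly n → Set
p ≈P q = ∀ m → coeff p m ≡ coeff q m

onePoly : ∀ {n} → Poly n
onePoly {n} = replicate n 0 ∷ []

varPoly : ∀ {n} → Fin n → Poly n
varPoly i = tabulate (λ j → if ⌊ i Fin.≟ j ⌋ then 1 else 0) ∷ []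

_+P_ : ∀ {n} → Poly n → Poly n → Poly n
p +P q = p ++ q

_*P_ : ∀ {n} → Poly n → Poly n → Poly n
p *P q = concatMap (λ m → map (zipWith _+_ m) q) p

scale : ∀ {n} → Bool → Poly n → Poly n
scale true  p = p
scale false p = []

-- standard arithmetization: x ↦ (1 - x) = 1 + x, ¬x ↦ x
arithLit : ∀ {n} → Literal n → Poly n
arithLit (i , true)  = onePoly +P varPoly i
arithLit (i , false) = varPoly i

arithClause : ∀ {n} → Clause n → Poly n
arithClause C = foldr (λ l acc → arithLit l *P acc) onePoly C

-- x² - x = x² + x over F_2
boolAx : ∀ {n} → Fin n → Poly n
boolAx i = (varPoly i *P varPoly i) +P varPoly i

data PCDeriv {n} (φ : CNF n) (d : ℕ) : Poly n → Set where
  axiom   : ∀ {C} → C ∈ φ → DegLe (arithClause C) d → PCDeriv φ d (arithClause C)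
  boolean : ∀ i → DegLe (boolAx i) d → PCDeriv φ d (boolAx i)
  lincomb : ∀ {p q} (α β : Bool) → PCDeriv φ d p → PCDeriv φ d q →
            DegLe (scale α p +P scale β q) d → PCDeriv φ d (scale α p +P scale β q)
  mult    : ∀ {p} (i : Fin n) → PCDeriv φ d p →
            DegLe (varPoly i *P p) d → PCDeriv φ d (varPoly i *P p)

PCRefutation : ∀ {n} → CNF n → ℕ → Set
PCRefutation {n} φ d = Σ (Poly n) (λ p → PCDeriv φ d p × (p ≈P onePoly))
  where open import Data.Product using (Σ)

-- Fix a Res(⊕) refutation of space s. For a configuration S and a selection es of one
-- equation from each clause of S, let Q(es) be the product of the indicator polynomials
-- f + α + 1 of the selected equations f = α. Going backwards through the refutation we show
-- that every Q(es) is derivable in PC of degree s + r + 1. At the last configuration this is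
-- vacuous (it contains the empty clause, which has no equation to select); at the first,
-- empty one the only selection gives Q = 1, a refutation.
--   * Erasing a clause C: Q(e ∷ es) = (f + α + 1) · Q(es) is a degree-one multiple.
--   * Downloading an axiom C: every Q(l ∷ es) with l a literal of C is derivable, and so is
--     Q(es) times the arithmetization of C; since the arithmetization of a literal plus the
--     indicator of its equation is 1, the literals of C can be cut away one at a time.
--   * Inferring D from S: the equations of es together with the negations of those of D
--     form an unsolvable affine system (D holds wherever es does), so by Gaussian elimination
--     1 is an F₂-combination of them. Q(es) times each negated equation of D is some
--     Q(e ∷ es), and Q(es) times a selected equation f + α is a multiple of
--     (f + α + 1)(f + α) = Σ fᵢ (xᵢ² + xᵢ), a sum of boolean axioms.

module Submission where

open import Defs
open import Algebra.Bundles using (CommutativeRing)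
open import Algebra.Structures using (IsCommutativeRing)
import Algebra.Properties.CommutativeSemigroup as CommutativeSemigroupProperties
open import Data.Bool using (Bool; true; false; not; _∧_; _xor_; T; if_then_else_)
import Data.Bool as Bool
open import Data.Bool.Properties
  using ( not-involutive; not-distribʳ-xor; T-not-≡; ¬-not; ∧-distribʳ-xor
        ; xor-assoc; xor-comm; xor-same; xor-identityʳ; xor-∧-commutativeRing)
open import Data.Empty using (⊥-elim)
open import Data.Fin using (Fin)
import Data.Fin as Fin
open import Data.List using (List; []; _∷_; _++_; length; map; concatMap; filter; foldr)
open import Data.List.Membership.Propositional using (_∈_; find; lose)
open import Data.List.Membership.Propositional.Properties
  using (∈-∃++; ∈-map⁻; ∈-map⁺; ∈-++⁻; ∈-++⁺ˡ; ∈-++⁺ʳ)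
open import Data.List.Properties using (length-filter; foldr-map; ++-assoc; ++-identityʳ)
open import Data.List.Relation.Binary.Permutation.Propositional using (_↭_; ↭-sym; ↭⇒↭ₛ′)
import Data.List.Relation.Binary.Permutation.Propositional as ↭
import Data.List.Relation.Binary.Permutation.Propositional.Properties as ↭ₚ
open import Data.List.Relation.Binary.Permutation.Setoid.Properties using (foldr-commMonoid)
open import Data.List.Relation.Binary.Pointwise using (Pointwise; []; _∷_)
open import Data.List.Relation.Binary.Pointwise.Properties using (Pointwise-length)
open import Data.List.Relation.Unary.All as All using (All; []; _∷_)
open import Data.List.Relation.Unary.All.Properties using (++⁺; ++⁻; concat⁺; map⁺; map⁻; ¬Any⇒All¬; All¬⇒¬Any)
open import Data.List.Relation.Unary.Any using (here; there; any?)
open import Data.List.Relation.Unary.Any.Properties using (any⁺; any⁻)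
open import Data.Nat using (ℕ; zero; suc; _+_; _≤_; _<_; z≤n; s≤s)
open import Data.Nat.Induction using (<-wellFounded)
import Data.Nat.Properties as ℕ
open import Data.Product using (Σ; _×_; _,_; proj₁; proj₂)
open import Data.Sum using (_⊎_; inj₁; inj₂)
open import Data.Vec using (Vec; zipWith; replicate; tabulate)
import Data.Vec as Vec
import Data.Vec.Properties as Vecₚ
open import Function using (_∘_)
open import Function.Bundles using (Equivalence)
open import Induction.WellFounded using (Acc; acc)
open import Level using (0ℓ)
open import Relation.Binary.Bundles using (Setoid)
open import Relation.Binary.Structures using (IsEquivalence)
open import Relation.Binary.PropositionalEquality
open import Relation.Nullary using (Dec; yes; no; ¬_; ¬?)
open import Relation.Nullary.Decidable using (⌊_⌋; ⌊⌋-map′)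

open CommutativeSemigroupProperties (CommutativeRing.+-commutativeSemigroup xor-∧-commutativeRing)
  using (interchange; x∙yz≈y∙xz)
open CommutativeSemigroupProperties ℕ.+-commutativeSemigroup
  using () renaming (interchange to +-interchange)

-- Parity sums and coefficients

xor≡false⇒≡ : ∀ {x y} → x xor y ≡ false → x ≡ y
xor≡false⇒≡ {false} refl = refl
xor≡false⇒≡ {true} {true} _ = refl

parity : {A : Set} → (A → Bool) → List A → Bool
parity h []      = false
parity h (a ∷ p) = h a xor parity h p

module _ {A : Set} where

  parity-++ : ∀ (h : A → Bool) p q → parity h (p ++ q) ≡ parity h p xor parity h q
  parity-++ h []      q = refl
  parity-++ h (a ∷ p) q = trans (cong (h a xor_) (parity-++ h p q)) (sym (xor-assoc (h a) _ _))

  parity-cong : ∀ {h h′ : A → Bool} → (∀ a → h a ≡ h′ a) → ∀ p → parity h p ≡ parity h′ p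
  parity-cong h≗h′ []      = refl
  parity-cong h≗h′ (a ∷ p) = cong₂ _xor_ (h≗h′ a) (parity-cong h≗h′ p)

  parity-false : ∀ p → parity (λ (_ : A) → false) p ≡ false
  parity-false []      = refl
  parity-false (a ∷ p) = parity-false p

  parity-xor : ∀ (h h′ : A → Bool) p → parity (λ a → h a xor h′ a) p ≡ parity h p xor parity h′ p
  parity-xor h h′ []      = refl
  parity-xor h h′ (a ∷ p) =
    trans (cong ((h a xor h′ a) xor_) (parity-xor h h′ p)) (interchange (h a) (h′ a) _ _)

module _ {A B : Set} where

  parity-map : ∀ (h : B → Bool) (g : A → B) p → parity h (map g p) ≡ parity (h ∘ g) p
  parity-map h g []      = refl
  parity-map h g (a ∷ p) = cong (h (g a) xor_) (parity-map h g p)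

  parity-concatMap : ∀ (h : B → Bool) (g : A → List B) p →
                     parity h (concatMap g p) ≡ parity (λ a → parity h (g a)) p
  parity-concatMap h g []      = refl
  parity-concatMap h g (a ∷ p) =
    trans (parity-++ h (g a) (concatMap g p)) (cong (parity h (g a) xor_) (parity-concatMap h g p))

  parity-swap : ∀ (F : A → B → Bool) p q →
                parity (λ a → parity (F a) q) p ≡ parity (λ b → parity (λ a → F a b) p) q
  parity-swap F []      q = sym (parity-false q)
  parity-swap F (a ∷ p) q =
    trans (cong (parity (F a) q xor_) (parity-swap F p q))
          (sym (parity-xor (F a) (λ b → parity (λ a → F a b) p) q))

module _ {n : ℕ} where

  infixl 7 _*ₘ_

  _≟ₘ_ : (a b : Monomial n) → Dec (a ≡ b)
  _≟ₘ_ = Vecₚ.≡-dec ℕ._≟_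

  δ : Monomial n → Monomial n → Bool
  δ m a = ⌊ a ≟ₘ m ⌋

  _*ₘ_ : Monomial n → Monomial n → Monomial n
  _*ₘ_ = zipWith _+_

  coeff≡parity : ∀ p m → coeff p m ≡ parity (δ m) p
  coeff≡parity []      m = refl
  coeff≡parity (a ∷ p) m = trans (if-not≡xor (δ m a)) (cong (δ m a xor_) (coeff≡parity p m))
    where
    if-not≡xor : ∀ c {b} → (if c then not b else b) ≡ c xor b
    if-not≡xor true  = refl
    if-not≡xor false = refl

  coeff-++ : ∀ p q m → coeff (p ++ q) m ≡ coeff p m xor coeff q m
  coeff-++ p q m = begin
    coeff (p ++ q) m                    ≡⟨ coeff≡parity (p ++ q) m ⟩
    parity (δ m) (p ++ q)               ≡⟨ parity-++ (δ m) p q ⟩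
    parity (δ m) p xor parity (δ m) q   ≡⟨ cong₂ _xor_ (coeff≡parity p m) (coeff≡parity q m) ⟨
    coeff p m xor coeff q m             ∎
    where open ≡-Reasoning

  parity-*P : ∀ h p q → parity h (p *P q) ≡ parity (λ a → parity (λ b → h (a *ₘ b)) q) p
  parity-*P h p q = trans (parity-concatMap h _ p) (parity-cong (λ a → parity-map h (a *ₘ_) q) p)

  coeff-*P : ∀ p q m → coeff (p *P q) m ≡ parity (λ a → parity (λ b → δ m (a *ₘ b)) q) p
  coeff-*P p q m = trans (coeff≡parity (p *P q) m) (parity-*P (δ m) p q)

  removeAll : Monomial n → Poly n → Poly n
  removeAll a = filter (λ b → ¬? (b ≟ₘ a))

  parity-removeAll : ∀ h a p → parity h p ≡ (parity (δ a) p ∧ h a) xor parity h (removeAll a p)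
  parity-removeAll h a []      = refl
  parity-removeAll h a (b ∷ p) with b ≟ₘ a
  ... | yes refl = trans (cong (h b xor_) (parity-removeAll h b p)) (absorb (parity (δ b) p) (h b))
    where
    absorb : ∀ c x {r} → x xor ((c ∧ x) xor r) ≡ (not c ∧ x) xor r
    absorb true  true  = not-involutive _
    absorb true  false = refl
    absorb false true  = refl
    absorb false false = refl
  ... | no _ = trans (cong (h b xor_) (parity-removeAll h a p)) (x∙yz≈y∙xz (h b) (parity (δ a) p ∧ h a) _)

  removeAll-shrinks : ∀ a p → length (removeAll a (a ∷ p)) < length (a ∷ p)
  removeAll-shrinks a p with a ≟ₘ a
  ... | yes _  = s≤s (length-filter (λ b → ¬? (b ≟ₘ a)) p)
  ... | no a≢a = ⊥-elim (a≢a refl)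

  removeAll-null : ∀ a p → p ≈P [] → removeAll a p ≈P []
  removeAll-null a p p≈0 m = begin
    coeff (removeAll a p) m                       ≡⟨ coeff≡parity (removeAll a p) m ⟩
    parity (δ m) p′                               ≡⟨ cong (λ c → (c ∧ δ m a) xor parity (δ m) p′) coeff-a ⟨
    (parity (δ a) p ∧ δ m a) xor parity (δ m) p′  ≡⟨ parity-removeAll (δ m) a p ⟨
    parity (δ m) p                                ≡⟨ coeff≡parity p m ⟨
    coeff p m                                     ≡⟨ p≈0 m ⟩
    false                                         ∎
    where
    open ≡-Reasoning
    p′ : Poly n
    p′ = removeAll a p
    coeff-a : parity (δ a) p ≡ false
    coeff-a = trans (sym (coeff≡parity p a)) (p≈0 a)

  parity-null : ∀ h p → p ≈P [] → parity h p ≡ false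
  parity-null h p = go p (<-wellFounded (length p))
    where
    open ≡-Reasoning
    go : ∀ p → Acc _<_ (length p) → p ≈P [] → parity h p ≡ false
    go []      _         _   = refl
    go (a ∷ p) (acc rec) p≈0 = begin
      parity h (a ∷ p)
        ≡⟨ parity-removeAll h a (a ∷ p) ⟩
      (parity (δ a) (a ∷ p) ∧ h a) xor parity h (removeAll a (a ∷ p))
        ≡⟨ cong (λ c → (c ∧ h a) xor parity h (removeAll a (a ∷ p)))
                (trans (sym (coeff≡parity (a ∷ p) a)) (p≈0 a)) ⟩
      parity h (removeAll a (a ∷ p))
        ≡⟨ go (removeAll a (a ∷ p)) (rec (removeAll-shrinks a p)) (removeAll-null a (a ∷ p) p≈0) ⟩
      false
        ∎

  parity-resp-≈P : ∀ h p q → p ≈P q → parity h p ≡ parity h q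
  parity-resp-≈P h p q p≈q = xor≡false⇒≡ (trans (sym (parity-++ h p q)) (parity-null h (p ++ q) p+q≈0))
    where
    p+q≈0 : (p ++ q) ≈P []
    p+q≈0 m = trans (coeff-++ p q m) (trans (cong (_xor coeff q m) (p≈q m)) (xor-same (coeff q m)))

-- The polynomial ring

-- A record rather than a synonym for _≈P_, so that p and q can be inferred from a proof.
infix 4 _≋_

record _≋_ {n : ℕ} (p q : Poly n) : Set where
  constructor mk≋
  field coeff-≡ : p ≈P q

open _≋_ public

module _ {n : ℕ} where

  ≋-isEquivalence : IsEquivalence (_≋_ {n})
  ≋-isEquivalence = record
    { refl  = mk≋ λ _ → refl
    ; sym   = λ p≋q → mk≋ λ m → sym (coeff-≡ p≋q m)
    ; trans = λ p≋q q≋r → mk≋ λ m → trans (coeff-≡ p≋q m) (coeff-≡ q≋r m)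
    }

  ≋-setoid : Setoid 0ℓ 0ℓ
  ≋-setoid = record { isEquivalence = ≋-isEquivalence }

  open Setoid ≋-setoid using () renaming (refl to ≋-refl; trans to ≋-trans; reflexive to ≡⇒≋)
  open import Algebra.Consequences.Setoid ≋-setoid using (comm∧idˡ⇒id; comm∧distrʳ⇒distr)

  +P-cong : ∀ {p p′ q q′ : Poly n} → p ≋ p′ → q ≋ q′ → p +P q ≋ p′ +P q′
  +P-cong {p} {p′} {q} {q′} p≋p′ q≋q′ = mk≋ λ m → begin
    coeff (p ++ q) m           ≡⟨ coeff-++ p q m ⟩
    coeff p m xor coeff q m    ≡⟨ cong₂ _xor_ (coeff-≡ p≋p′ m) (coeff-≡ q≋q′ m) ⟩
    coeff p′ m xor coeff q′ m  ≡⟨ coeff-++ p′ q′ m ⟨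
    coeff (p′ ++ q′) m         ∎
    where open ≡-Reasoning

  +P-comm : ∀ (p q : Poly n) → p +P q ≋ q +P p
  +P-comm p q = mk≋ λ m →
    trans (coeff-++ p q m) (trans (xor-comm (coeff p m) _) (sym (coeff-++ q p m)))

  +P-self : ∀ (p : Poly n) → p +P p ≋ []
  +P-self p = mk≋ λ m → trans (coeff-++ p p m) (xor-same (coeff p m))

  *P-congʳ : ∀ {p p′ : Poly n} (q : Poly n) → p ≋ p′ → p *P q ≋ p′ *P q
  *P-congʳ {p} {p′} q p≋p′ = mk≋ λ m →
    trans (coeff-*P p q m) (trans (parity-resp-≈P _ p p′ (coeff-≡ p≋p′)) (sym (coeff-*P p′ q m)))

  *P-congˡ : ∀ (p : Poly n) {q q′ : Poly n} → q ≋ q′ → p *P q ≋ p *P q′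
  *P-congˡ p {q} {q′} q≋q′ = mk≋ λ m →
    trans (coeff-*P p q m)
      (trans (parity-cong (λ a → parity-resp-≈P _ q q′ (coeff-≡ q≋q′)) p) (sym (coeff-*P p q′ m)))

  *P-comm : ∀ (p q : Poly n) → p *P q ≋ q *P p
  *P-comm p q = mk≋ λ m → begin
    coeff (p *P q) m                                  ≡⟨ coeff-*P p q m ⟩
    parity (λ a → parity (λ b → δ m (a *ₘ b)) q) p   ≡⟨ parity-swap _ p q ⟩
    parity (λ b → parity (λ a → δ m (a *ₘ b)) p) q   ≡⟨ parity-cong (λ b → parity-cong (λ a →
                                                           cong (δ m) (Vecₚ.zipWith-comm ℕ.+-comm a b)) p) q ⟩
    parity (λ b → parity (λ a → δ m (b *ₘ a)) p) q   ≡⟨ coeff-*P q p m ⟨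
    coeff (q *P p) m                                  ∎
    where open ≡-Reasoning

  *P-assoc : ∀ (p q r : Poly n) → (p *P q) *P r ≋ p *P (q *P r)
  *P-assoc p q r = mk≋ λ m → begin
    coeff ((p *P q) *P r) m
      ≡⟨ coeff-*P (p *P q) r m ⟩
    parity (λ ab → parity (λ c → δ m (ab *ₘ c)) r) (p *P q)
      ≡⟨ parity-*P _ p q ⟩
    parity (λ a → parity (λ b → parity (λ c → δ m ((a *ₘ b) *ₘ c)) r) q) p
      ≡⟨ parity-cong (λ a → parity-cong (λ b → parity-cong (λ c →
           cong (δ m) (Vecₚ.zipWith-assoc ℕ.+-assoc a b c)) r) q) p ⟩
    parity (λ a → parity (λ b → parity (λ c → δ m (a *ₘ (b *ₘ c))) r) q) p
      ≡⟨ parity-cong (λ a → parity-*P (λ bc → δ m (a *ₘ bc)) q r) p ⟨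
    parity (λ a → parity (λ bc → δ m (a *ₘ bc)) (q *P r)) p
      ≡⟨ coeff-*P p (q *P r) m ⟨
    coeff (p *P (q *P r)) m
      ∎
    where open ≡-Reasoning

  *P-identityˡ : ∀ (p : Poly n) → onePoly *P p ≋ p
  *P-identityˡ p = mk≋ λ m → begin
    coeff (onePoly *P p) m                                ≡⟨ coeff-*P onePoly p m ⟩
    parity (λ b → δ m (replicate n 0 *ₘ b)) p xor false  ≡⟨ xor-identityʳ _ ⟩
    parity (λ b → δ m (replicate n 0 *ₘ b)) p            ≡⟨ parity-cong (λ b →
                                                               cong (δ m) (Vecₚ.zipWith-identityˡ ℕ.+-identityˡ b)) p ⟩
    parity (δ m) p                                        ≡⟨ coeff≡parity p m ⟨
    coeff p m                                             ∎
    where open ≡-Reasoning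

  *P-distribʳ : ∀ (r p q : Poly n) → (p +P q) *P r ≋ (p *P r) +P (q *P r)
  *P-distribʳ r p q = mk≋ λ m → begin
    coeff ((p ++ q) *P r) m                ≡⟨ coeff-*P (p ++ q) r m ⟩
    parity _ (p ++ q)                      ≡⟨ parity-++ _ p q ⟩
    parity _ p xor parity _ q              ≡⟨ cong₂ _xor_ (coeff-*P p r m) (coeff-*P q r m) ⟨
    coeff (p *P r) m xor coeff (q *P r) m  ≡⟨ coeff-++ (p *P r) (q *P r) m ⟨
    coeff ((p *P r) ++ (q *P r)) m         ∎
    where open ≡-Reasoning

  polyIsCommutativeRing : IsCommutativeRing _≋_ _+P_ _*P_ (λ p → p) [] onePoly
  polyIsCommutativeRing = record
    { isRing = record
      { +-isAbelianGroup = record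
        { isGroup = record
          { isMonoid = record
            { isSemigroup = record
              { isMagma = record { isEquivalence = ≋-isEquivalence ; ∙-cong = +P-cong }
              ; assoc   = λ p q r → ≡⇒≋ (++-assoc p q r)
              }
            ; identity = (λ _ → ≋-refl) , (λ p → ≡⇒≋ (++-identityʳ p))
            }
          ; inverse = +P-self , +P-self
          ; ⁻¹-cong = λ p≋q → p≋q
          }
        ; comm = +P-comm
        }
      ; *-cong     = λ {p} {p′} {q} {q′} p≋p′ q≋q′ → ≋-trans (*P-congʳ q p≋p′) (*P-congˡ p′ q≋q′)
      ; *-assoc    = *P-assoc
      ; *-identity = comm∧idˡ⇒id *P-comm *P-identityˡ
      ; distrib    = comm∧distrʳ⇒distr +P-cong *P-comm *P-distribʳ
      }
    ; *-comm = *P-comm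
    }

polyRing : ℕ → CommutativeRing 0ℓ 0ℓ
polyRing n = record { isCommutativeRing = polyIsCommutativeRing {n} }

module P {n : ℕ} = CommutativeRing (polyRing n)

module _ {n : ℕ} where

  open import Relation.Binary.Reasoning.Setoid (P.setoid {n})

  square-+P : ∀ (p q : Poly n) → ((p +P q) *P (p +P q)) ≋ ((p *P p) +P (q *P q))
  square-+P p q = begin
    (p +P q) *P (p +P q)                   ≈⟨ P.distribʳ (p +P q) p q ⟩
    (p *P (p +P q)) +P (q *P (p +P q))     ≈⟨ P.+-cong (P.distribˡ p p q) (P.distribˡ q p q) ⟩
    (pp +P (p *P q)) +P ((q *P p) +P qq)   ≈⟨ P.+-congˡ {x = pp +P (p *P q)} (P.+-congʳ {x = qq} (P.*-comm q p)) ⟩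
    (pp +P (p *P q)) +P ((p *P q) +P qq)   ≈⟨ P.+-assoc pp (p *P q) _ ⟩
    pp +P ((p *P q) +P ((p *P q) +P qq))   ≈⟨ P.+-congˡ {x = pp} (P.+-assoc (p *P q) (p *P q) qq) ⟨
    pp +P (((p *P q) +P (p *P q)) +P qq)   ≈⟨ P.+-congˡ {x = pp} (P.+-congʳ {x = qq} (+P-self (p *P q))) ⟩
    pp +P qq                               ∎
    where
    pp qq : Poly n
    pp = p *P p
    qq = q *P q

  cut-identity : ∀ (Q A a t : Poly n) → (a +P t) ≋ onePoly →
                 ((Q *P (a *P A)) +P (A *P (t *P Q))) ≋ (Q *P A)
  cut-identity Q A a t a+t≈1 = begin
    (Q *P (a *P A)) +P (A *P (t *P Q))   ≈⟨ P.+-congˡ {x = Q *P (a *P A)} A·tQ≈Q·tA ⟩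
    (Q *P (a *P A)) +P (Q *P (t *P A))   ≈⟨ P.distribˡ Q (a *P A) (t *P A) ⟨
    Q *P ((a *P A) +P (t *P A))          ≈⟨ P.*-congˡ {x = Q} (P.distribʳ A a t) ⟨
    Q *P ((a +P t) *P A)                 ≈⟨ P.*-congˡ {x = Q} (P.*-congʳ {x = A} a+t≈1) ⟩
    Q *P (onePoly *P A)                  ≈⟨ P.*-congˡ {x = Q} (P.*-identityˡ A) ⟩
    Q *P A                               ∎
    where
    A·tQ≈Q·tA : (A *P (t *P Q)) ≋ (Q *P (t *P A))
    A·tQ≈Q·tA = P.trans (P.*-comm A (t *P Q)) (P.trans (P.*-congʳ {x = A} (P.*-comm t Q)) (P.*-assoc Q t A))

module _ {n : ℕ} where

  MonomialsDegLe : Poly n → ℕ → Set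
  MonomialsDegLe p d = All (λ a → monoDeg a ≤ d) p

  coeff-true⇒∈ : ∀ (p : Poly n) m → T (coeff p m) → m ∈ p
  coeff-true⇒∈ (a ∷ p) m t with a ≟ₘ m
  ... | yes refl = here refl
  ... | no _     = there (coeff-true⇒∈ p m t)

  DegLe-from-monomials : ∀ {p : Poly n} {d} → MonomialsDegLe p d → DegLe p d
  DegLe-from-monomials {p} p≤d m t = All.lookup p≤d (coeff-true⇒∈ p m t)

  DegLe-resp-≋ : ∀ {p q : Poly n} {d} → p ≋ q → DegLe p d → DegLe q d
  DegLe-resp-≋ p≋q p≤d m t = p≤d m (subst T (sym (coeff-≡ p≋q m)) t)

  monoDeg-*ₘ : ∀ (a b : Monomial n) → monoDeg (a *ₘ b) ≡ monoDeg a + monoDeg b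
  monoDeg-*ₘ = go
    where
    go : ∀ {k} (a b : Vec ℕ k) → Vec.sum (zipWith _+_ a b) ≡ Vec.sum a + Vec.sum b
    go Vec.[]      Vec.[]      = refl
    go (x Vec.∷ a) (y Vec.∷ b) = trans (cong (x + y +_) (go a b)) (+-interchange x y _ _)

  MonomialsDegLe-mono : ∀ {p : Poly n} {d d′} → d ≤ d′ → MonomialsDegLe p d → MonomialsDegLe p d′
  MonomialsDegLe-mono d≤d′ = All.map (λ a≤d → ℕ.≤-trans a≤d d≤d′)

  MonomialsDegLe-*P : ∀ {p q : Poly n} {d₁ d₂} →
                      MonomialsDegLe p d₁ → MonomialsDegLe q d₂ → MonomialsDegLe (p *P q) (d₁ + d₂)
  MonomialsDegLe-*P p≤ q≤ = concat⁺ (map⁺ (All.map (λ {a} a≤ → map⁺ (All.map (λ {b} b≤ →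
    subst (_≤ _) (sym (monoDeg-*ₘ a b)) (ℕ.+-mono-≤ a≤ b≤)) q≤)) p≤))

  1ₘ : Monomial n
  1ₘ = replicate n 0

  xₘ : Fin n → Monomial n
  xₘ i = tabulate (λ j → if ⌊ i Fin.≟ j ⌋ then 1 else 0)

  data AffineMonomial : Monomial n → Set where
    one : AffineMonomial 1ₘ
    var : ∀ i → AffineMonomial (xₘ i)

  Affine : Poly n → Set
  Affine = All AffineMonomial

monoDeg-1ₘ : ∀ n → monoDeg (1ₘ {n}) ≡ 0
monoDeg-1ₘ zero    = refl
monoDeg-1ₘ (suc n) = monoDeg-1ₘ n

monoDeg-xₘ : ∀ {n} (i : Fin n) → monoDeg (xₘ i) ≡ 1
monoDeg-xₘ {suc n} Fin.zero    = cong suc (sum-zeros n)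
  where
  sum-zeros : ∀ k → Vec.sum (tabulate {k} (λ _ → 0)) ≡ 0
  sum-zeros zero    = refl
  sum-zeros (suc k) = sum-zeros k
monoDeg-xₘ {suc n} (Fin.suc i) =
  trans (cong Vec.sum (Vecₚ.tabulate-cong (λ j → cong (if_then 1 else 0) (⌊⌋-map′ _ _ (i Fin.≟ j)))))
        (monoDeg-xₘ i)

module _ {n : ℕ} where

  MonomialsDegLe-affine : ∀ {q : Poly n} → Affine q → MonomialsDegLe q 1
  MonomialsDegLe-affine = All.map affine≤1
    where
    affine≤1 : ∀ {a} → AffineMonomial a → monoDeg a ≤ 1
    affine≤1 one     = subst (_≤ 1) (sym (monoDeg-1ₘ n)) z≤n
    affine≤1 (var i) = ℕ.≤-reflexive (monoDeg-xₘ i)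

  MonomialsDegLe-one : MonomialsDegLe (onePoly {n}) 0
  MonomialsDegLe-one = ℕ.≤-reflexive (monoDeg-1ₘ n) ∷ []

  MonomialsDegLe-boolAx : ∀ i → MonomialsDegLe (boolAx {n} i) 2
  MonomialsDegLe-boolAx i = ++⁺ (MonomialsDegLe-*P x≤1 x≤1) (MonomialsDegLe-mono (ℕ.n≤1+n 1) x≤1)
    where
    x≤1 : MonomialsDegLe (varPoly i) 1
    x≤1 = MonomialsDegLe-affine (var i ∷ [])

  ∏ : {A : Set} → (A → Poly n) → List A → Poly n
  ∏ g = foldr (λ a acc → g a *P acc) onePoly

  MonomialsDegLe-∏ : ∀ {A : Set} {g : A → Poly n} → (∀ a → Affine (g a)) →
                     ∀ as → MonomialsDegLe (∏ g as) (length as)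
  MonomialsDegLe-∏ g-aff []       = MonomialsDegLe-one
  MonomialsDegLe-∏ g-aff (a ∷ as) = MonomialsDegLe-*P (MonomialsDegLe-affine (g-aff a)) (MonomialsDegLe-∏ g-aff as)

  arithLit-affine : ∀ l → Affine (arithLit {n} l)
  arithLit-affine (i , true)  = one ∷ var i ∷ []
  arithLit-affine (i , false) = var i ∷ []

-- Affine forms as polynomials

module _ {n : ℕ} where

  open CommutativeSemigroupProperties (P.+-commutativeSemigroup {n})
    using () renaming (interchange to +P-interchange)
  open import Relation.Binary.Reasoning.Setoid (P.setoid {n})

  ∑ : ∀ k → (Fin k → Poly n) → Poly n
  ∑ zero    g = []
  ∑ (suc k) g = g Fin.zero +P ∑ k (g ∘ Fin.suc)

  when : Bool → Poly n → Poly n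
  when b p = if b then p else []

  ∑-cong : ∀ k {g h : Fin k → Poly n} → (∀ j → g j ≋ h j) → ∑ k g ≋ ∑ k h
  ∑-cong zero    g≋h = P.refl
  ∑-cong (suc k) g≋h = P.+-cong (g≋h Fin.zero) (∑-cong k (g≋h ∘ Fin.suc))

  ∑-zero : ∀ k → ∑ k (λ _ → []) ≋ []
  ∑-zero zero    = P.refl
  ∑-zero (suc k) = ∑-zero k

  ∑-distrib-+P : ∀ k (g h : Fin k → Poly n) → ∑ k (λ j → g j +P h j) ≋ (∑ k g +P ∑ k h)
  ∑-distrib-+P zero    g h = P.refl
  ∑-distrib-+P (suc k) g h = P.trans (P.+-congˡ (∑-distrib-+P k (g ∘ Fin.suc) (h ∘ Fin.suc)))
                                     (+P-interchange (g Fin.zero) (h Fin.zero) _ _)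

  *P-distribˡ-∑ : ∀ r k (g : Fin k → Poly n) → (r *P ∑ k g) ≋ ∑ k (λ j → r *P g j)
  *P-distribˡ-∑ r zero    g = P.zeroʳ r
  *P-distribˡ-∑ r (suc k) g = P.trans (P.distribˡ r (g Fin.zero) _) (P.+-congˡ (*P-distribˡ-∑ r k (g ∘ Fin.suc)))

  ∑-δ : ∀ {k} (i : Fin k) (g : Fin k → Poly n) → ∑ k (λ j → when ⌊ i Fin.≟ j ⌋ (g j)) ≋ g i
  ∑-δ {suc k} Fin.zero    g = P.trans (P.+-congˡ (∑-zero k)) (P.+-identityʳ (g Fin.zero))
  ∑-δ {suc k} (Fin.suc i) g = P.trans
    (∑-cong k (λ j → P.reflexive (cong (λ b → when b (g (Fin.suc j))) (⌊⌋-map′ _ _ (i Fin.≟ j)))))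
    (∑-δ i (g ∘ Fin.suc))

  ∑-square : ∀ k (g : Fin k → Poly n) → (∑ k g *P ∑ k g) ≋ ∑ k (λ j → g j *P g j)
  ∑-square zero    g = P.refl
  ∑-square (suc k) g = P.trans (square-+P (g Fin.zero) _) (P.+-congˡ (∑-square k (g ∘ Fin.suc)))

  ∑-all : ∀ {Q : Monomial n → Set} k (g : Fin k → Poly n) → (∀ j → All Q (g j)) → All Q (∑ k g)
  ∑-all zero    g all = []
  ∑-all (suc k) g all = ++⁺ (all Fin.zero) (∑-all k (g ∘ Fin.suc) (all ∘ Fin.suc))

  when-xor : ∀ b c (p : Poly n) → when (b xor c) p ≋ (when b p +P when c p)
  when-xor true  true  p = P.sym (+P-self p)
  when-xor true  false p = P.sym (P.+-identityʳ p)
  when-xor false c     p = P.refl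

  when-square : ∀ b (p : Poly n) → (when b p *P when b p) ≋ when b (p *P p)
  when-square true  p = P.refl
  when-square false p = P.refl

  when-+P : ∀ b (p q : Poly n) → (when b p +P when b q) ≋ when b (p +P q)
  when-+P true  p q = P.refl
  when-+P false p q = P.refl

  MonomialsDegLe-when : ∀ b {p d} → MonomialsDegLe p d → MonomialsDegLe (when b p) d
  MonomialsDegLe-when true  p≤d = p≤d
  MonomialsDegLe-when false p≤d = []

  linPoly : LinForm n → Poly n
  linPoly f = ∑ n (λ j → when (Vec.lookup f j) (varPoly j))

  linPoly-unitForm : ∀ i → linPoly (unitForm i) ≋ varPoly i
  linPoly-unitForm i = P.trans
    (∑-cong n (λ j → P.reflexive (cong (λ b → when b (varPoly j)) (Vecₚ.lookup∘tabulate _ j))))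
    (∑-δ i varPoly)

  linPoly-xor : ∀ f g → linPoly (zipWith _xor_ f g) ≋ (linPoly f +P linPoly g)
  linPoly-xor f g = P.trans
    (∑-cong n (λ j → P.trans (P.reflexive (cong (λ b → when b (varPoly j)) (Vecₚ.lookup-zipWith _xor_ j f g)))
                             (when-xor (Vec.lookup f j) (Vec.lookup g j) (varPoly j))))
    (∑-distrib-+P n _ _)

  linPoly-zero : linPoly (replicate n false) ≋ []
  linPoly-zero = P.trans
    (∑-cong n (λ j → P.reflexive (cong (λ b → when b (varPoly j)) (Vecₚ.lookup-replicate j false))))
    (∑-zero n)

  booleanSum : LinForm n → Poly n
  booleanSum f = ∑ n (λ j → when (Vec.lookup f j) (boolAx j))

  linPoly-square+linPoly : ∀ f → ((linPoly f *P linPoly f) +P linPoly f) ≋ booleanSum f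
  linPoly-square+linPoly f = begin
    (linPoly f *P linPoly f) +P linPoly f   ≈⟨ P.+-congʳ (∑-square n g) ⟩
    ∑ n (λ j → g j *P g j) +P ∑ n g         ≈⟨ ∑-distrib-+P n _ g ⟨
    ∑ n (λ j → (g j *P g j) +P g j)         ≈⟨ ∑-cong n (λ j → P.trans
                                                 (P.+-congʳ (when-square (Vec.lookup f j) (varPoly j)))
                                                 (when-+P (Vec.lookup f j) _ (varPoly j))) ⟩
    booleanSum f                            ∎
    where
    g : Fin n → Poly n
    g j = when (Vec.lookup f j) (varPoly j)

  infixl 6 _⊕_

  _⊕_ : LinEq n → LinEq n → LinEq n
  (f , α) ⊕ (g , β) = zipWith _xor_ f g , α xor β

  negate : LinEq n → LinEq n
  negate (f , α) = f , not α

  affinePoly : LinEq n → Poly n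
  affinePoly (f , α) = linPoly f +P when α onePoly

  -- f + α + 1, the polynomial that is 1 exactly where the equation f = α holds
  indicatorPoly : LinEq n → Poly n
  indicatorPoly e = affinePoly (negate e)

  affinePoly-⊕ : ∀ a b → affinePoly (a ⊕ b) ≋ (affinePoly a +P affinePoly b)
  affinePoly-⊕ (f , α) (g , β) = P.trans (P.+-cong (linPoly-xor f g) (when-xor α β onePoly))
                                         (+P-interchange (linPoly f) (linPoly g) _ _)

  affinePoly-one : affinePoly (replicate n false , true) ≋ onePoly
  affinePoly-one = P.+-congʳ linPoly-zero

  affinePoly-affine : ∀ e → Affine (affinePoly e)
  affinePoly-affine (f , α) = ++⁺ (∑-all n _ (λ j → when-var (Vec.lookup f j) j)) (when-one α)
    where
    when-var : ∀ b j → Affine (when b (varPoly j))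
    when-var true  j = var j ∷ []
    when-var false j = []
    when-one : ∀ b → Affine (when b onePoly)
    when-one true  = one ∷ []
    when-one false = []

  indicatorPoly-affine : ∀ (e : LinEq n) → Affine (indicatorPoly e)
  indicatorPoly-affine e = affinePoly-affine (negate e)

  indicatorPoly*affinePoly : ∀ e → (indicatorPoly e *P affinePoly e) ≋ booleanSum (proj₁ e)
  indicatorPoly*affinePoly (f , true) = begin
    (L +P []) *P (L +P onePoly)  ≈⟨ P.*-congʳ {x = L +P onePoly} (P.+-identityʳ L) ⟩
    L *P (L +P onePoly)          ≈⟨ P.distribˡ L L onePoly ⟩
    (L *P L) +P (L *P onePoly)   ≈⟨ P.+-congˡ {x = L *P L} (P.*-identityʳ L) ⟩
    (L *P L) +P L                ≈⟨ linPoly-square+linPoly f ⟩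
    booleanSum f                 ∎
    where
    L : Poly n
    L = linPoly f
  indicatorPoly*affinePoly (f , false) = begin
    (L +P onePoly) *P (L +P [])  ≈⟨ P.*-congˡ {x = L +P onePoly} (P.+-identityʳ L) ⟩
    (L +P onePoly) *P L          ≈⟨ P.distribʳ L L onePoly ⟩
    (L *P L) +P (onePoly *P L)   ≈⟨ P.+-congˡ {x = L *P L} (P.*-identityˡ L) ⟩
    (L *P L) +P L                ≈⟨ linPoly-square+linPoly f ⟩
    booleanSum f                 ∎
    where
    L : Poly n
    L = linPoly f

  arithLit+indicatorPoly : ∀ l → (arithLit l +P indicatorPoly (linLit l)) ≋ onePoly
  arithLit+indicatorPoly (i , true) = begin
    (onePoly +P varPoly i) +P (linPoly (unitForm i) +P [])  ≈⟨ P.+-congˡ {x = onePoly +P varPoly i}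
                                                                 (P.trans (P.+-identityʳ _) (linPoly-unitForm i)) ⟩
    (onePoly +P varPoly i) +P varPoly i                     ≈⟨ P.+-assoc onePoly (varPoly i) (varPoly i) ⟩
    onePoly +P (varPoly i +P varPoly i)                     ≈⟨ P.+-congˡ {x = onePoly} (+P-self (varPoly i)) ⟩
    onePoly +P []                                           ≈⟨ P.+-identityʳ onePoly ⟩
    onePoly                                                 ∎
  arithLit+indicatorPoly (i , false) = begin
    varPoly i +P (linPoly (unitForm i) +P onePoly)  ≈⟨ P.+-congˡ {x = varPoly i} (P.+-congʳ (linPoly-unitForm i)) ⟩
    varPoly i +P (varPoly i +P onePoly)             ≈⟨ P.+-assoc (varPoly i) (varPoly i) onePoly ⟨
    (varPoly i +P varPoly i) +P onePoly             ≈⟨ P.+-congʳ (+P-self (varPoly i)) ⟩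
    onePoly                                         ∎

-- Derivations of bounded degree

module Derivability {n : ℕ} (φ : CNF n) (d : ℕ) where

  infix 2 ⊢_

  ⊢_ : Poly n → Set
  ⊢ q = Σ (Poly n) λ p → PCDeriv φ d p × p ≋ q

  ⊢-resp-≋ : ∀ {p q} → p ≋ q → ⊢ p → ⊢ q
  ⊢-resp-≋ p≋q (p′ , π , p′≋p) = p′ , π , P.trans p′≋p p≋q

  ⊢-+P : ∀ {p q} → DegLe (p +P q) d → ⊢ p → ⊢ q → ⊢ p +P q
  ⊢-+P {p} {q} p+q≤d (p′ , π , p′≋p) (q′ , ϖ , q′≋q) =
    p′ +P q′ , lincomb true true π ϖ (DegLe-resp-≋ (P.sym p′+q′≋p+q) p+q≤d) , p′+q′≋p+q
    where
    p′+q′≋p+q : p′ +P q′ ≋ p +P q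
    p′+q′≋p+q = P.+-cong p′≋p q′≋q

  ⊢-zero : ∀ {p} → ⊢ p → ⊢ []
  ⊢-zero (_ , π , _) = [] , lincomb false false π π (λ _ ()) , P.refl

  ⊢-varPoly*P : ∀ {p} i → DegLe (varPoly i *P p) d → ⊢ p → ⊢ varPoly i *P p
  ⊢-varPoly*P {p} i xp≤d (p′ , π , p′≋p) =
    varPoly i *P p′ , mult i π (DegLe-resp-≋ (P.sym xp′≋xp) xp≤d) , xp′≋xp
    where
    xp′≋xp : varPoly i *P p′ ≋ varPoly i *P p
    xp′≋xp = P.*-congˡ {x = varPoly i} p′≋p

  ⊢-axiom : ∀ {C} → C ∈ φ → length C ≤ d → ⊢ arithClause C
  ⊢-axiom {C} C∈φ C≤d = arithClause C , axiom C∈φ C≤d′ , P.refl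
    where
    C≤d′ : DegLe (arithClause C) d
    C≤d′ = DegLe-from-monomials (MonomialsDegLe-mono C≤d (MonomialsDegLe-∏ arithLit-affine C))

  ⊢-boolAx : 2 ≤ d → ∀ i → ⊢ boolAx i
  ⊢-boolAx 2≤d i =
    boolAx i , boolean i (DegLe-from-monomials (MonomialsDegLe-mono 2≤d (MonomialsDegLe-boolAx i))) , P.refl

  ⊢-∑ : ⊢ [] → ∀ k (g : Fin k → Poly n) → (∀ j → MonomialsDegLe (g j) d) → (∀ j → ⊢ g j) → ⊢ ∑ k g
  ⊢-∑ ⊢0 zero    g g≤d ⊢g = ⊢0
  ⊢-∑ ⊢0 (suc k) g g≤d ⊢g =
    ⊢-+P (DegLe-from-monomials (++⁺ (g≤d Fin.zero) (∑-all k _ (g≤d ∘ Fin.suc))))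
      (⊢g Fin.zero) (⊢-∑ ⊢0 k (g ∘ Fin.suc) (g≤d ∘ Fin.suc) (⊢g ∘ Fin.suc))

  ⊢-affine*P : ∀ {q p k} → Affine q → MonomialsDegLe p k → suc k ≤ d → ⊢ p → ⊢ q *P p
  ⊢-affine*P []                          p≤k k<d ⊢p = ⊢-zero ⊢p
  ⊢-affine*P {a ∷ q} {p} (a-aff ∷ q-aff) p≤k k<d ⊢p =
    ⊢-+P (degLe (a-aff ∷ q-aff)) (⊢-monomial*P a-aff) (⊢-affine*P q-aff p≤k k<d ⊢p)
    where
    degLe : ∀ {q} → Affine q → DegLe (q *P p) d
    degLe q-aff = DegLe-from-monomials (MonomialsDegLe-mono k<d (MonomialsDegLe-*P (MonomialsDegLe-affine q-aff) p≤k))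
    ⊢-monomial*P : ∀ {a} → AffineMonomial a → ⊢ map (a *ₘ_) p
    ⊢-monomial*P one     = ⊢-resp-≋ (P.trans (P.sym (*P-identityˡ p)) (P.+-identityʳ _)) ⊢p
    ⊢-monomial*P (var i) = ⊢-resp-≋ (P.+-identityʳ _) (⊢-varPoly*P i (degLe (var i ∷ [])) ⊢p)

  ⊢-∏*P : ∀ {A : Set} {g : A → Poly n} → (∀ a → Affine (g a)) →
          ∀ as {p k} → MonomialsDegLe p k → length as + k ≤ d → ⊢ p → ⊢ ∏ g as *P p
  ⊢-∏*P g-aff []       {p} p≤k k≤d ⊢p = ⊢-resp-≋ (P.sym (*P-identityˡ p)) ⊢p
  ⊢-∏*P {g = g} g-aff (a ∷ as) {p} p≤k as+k<d ⊢p =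
    ⊢-resp-≋ (P.sym (P.*-assoc (g a) (∏ g as) p))
      (⊢-affine*P (g-aff a) (MonomialsDegLe-*P (MonomialsDegLe-∏ g-aff as) p≤k) as+k<d
        (⊢-∏*P g-aff as p≤k (ℕ.≤-trans (ℕ.n≤1+n _) as+k<d) ⊢p))

  ⊢-cut-literals : ∀ {Q k} (L : Clause n) → MonomialsDegLe Q k → length L + k ≤ d → suc k ≤ d →
                   (∀ {l} → l ∈ L → ⊢ indicatorPoly (linLit l) *P Q) → ⊢ Q *P arithClause L → ⊢ Q
  ⊢-cut-literals {Q} []          Q≤k _      _   _    ⊢Q·1   = ⊢-resp-≋ (P.*-identityʳ Q) ⊢Q·1
  ⊢-cut-literals {Q} {k} (l ∷ L) Q≤k lL+k≤d k<d ⊢t·Q ⊢Q·lL =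
    ⊢-cut-literals L Q≤k (ℕ.≤-trans (ℕ.n≤1+n _) lL+k≤d) k<d (⊢t·Q ∘ there)
      (⊢-resp-≋ (cut-identity Q A (arithLit l) t (arithLit+indicatorPoly l)) (⊢-+P degLe ⊢Q·lL ⊢A·tQ))
    where
    A t : Poly n
    A = arithClause L
    t = indicatorPoly (linLit l)
    L+1+k≤d : length L + suc k ≤ d
    L+1+k≤d = subst (_≤ d) (sym (ℕ.+-suc (length L) k)) lL+k≤d
    tQ≤1+k : MonomialsDegLe (t *P Q) (suc k)
    tQ≤1+k = MonomialsDegLe-*P (MonomialsDegLe-affine (indicatorPoly-affine (linLit l))) Q≤k
    ⊢A·tQ : ⊢ A *P (t *P Q)
    ⊢A·tQ = ⊢-∏*P arithLit-affine L tQ≤1+k L+1+k≤d (⊢t·Q (here refl))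
    degLe : DegLe ((Q *P arithClause (l ∷ L)) +P (A *P (t *P Q))) d
    degLe = DegLe-from-monomials (++⁺
      (MonomialsDegLe-mono (subst (_≤ d) (ℕ.+-comm (length (l ∷ L)) k) lL+k≤d)
        (MonomialsDegLe-*P Q≤k (MonomialsDegLe-∏ arithLit-affine (l ∷ L))))
      (MonomialsDegLe-mono L+1+k≤d (MonomialsDegLe-*P (MonomialsDegLe-∏ arithLit-affine L) tQ≤1+k)))

-- PC has no rule creating 0 from nothing; an unsatisfiable φ has a clause to start from.
zero-derivable : ∀ {n r d} (φ : CNF n) → IsRCNF r φ → Unsatisfiable φ → r ≤ d → Derivability.⊢_ φ d []
zero-derivable []      _                 φ-unsat _ with () ← φ-unsat (λ _ → false)
zero-derivable {d = d} (C ∷ φ) ((_ , C≤r) ∷ _) _ r≤d = ⊢-zero (⊢-axiom (here refl) (ℕ.≤-trans C≤r r≤d))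
  where open Derivability (C ∷ φ) d

-- Gaussian elimination over F₂

find-true : ∀ {A : Set} (p : A → Bool) xs → (Σ A λ x → x ∈ xs × p x ≡ true) ⊎ All (λ x → p x ≡ false) xs
find-true p xs with any? (λ x → p x Bool.≟ true) xs
... | yes some = inj₁ (find some)
... | no none  = inj₂ (All.map ¬-not (¬Any⇒All¬ xs none))

value : ∀ {n} → Assignment n → LinEq n → Bool
value ρ (f , α) = evalForm ρ f xor α

Solves : ∀ {n} → Assignment n → List (LinEq n) → Set
Solves ρ G = All (λ a → value ρ a ≡ false) G

infix 4 _∈span_

data _∈span_ {n} : LinEq n → List (LinEq n) → Set where
  gen : ∀ {a G} → a ∈ G → a ∈span G
  add : ∀ {a b G} → a ∈span G → b ∈span G → a ⊕ b ∈span G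

span-mono : ∀ {n} {G G′ : List (LinEq n)} → (∀ {a} → a ∈ G′ → a ∈span G) →
            ∀ {b} → b ∈span G′ → b ∈span G
span-mono G′⊆G (gen b∈G′) = G′⊆G b∈G′
span-mono G′⊆G (add a b)  = add (span-mono G′⊆G a) (span-mono G′⊆G b)

evalForm-xor : ∀ {n} (ρ : Assignment n) f g → evalForm ρ (zipWith _xor_ f g) ≡ evalForm ρ f xor evalForm ρ g
evalForm-xor ρ Vec.[]      Vec.[]      = refl
evalForm-xor ρ (b Vec.∷ f) (c Vec.∷ g) = begin
  ((b xor c) ∧ x) xor evalForm ρ′ (zipWith _xor_ f g)
    ≡⟨ cong₂ _xor_ (∧-distribʳ-xor x b c) (evalForm-xor ρ′ f g) ⟩
  ((b ∧ x) xor (c ∧ x)) xor (evalForm ρ′ f xor evalForm ρ′ g)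
    ≡⟨ interchange (b ∧ x) _ _ _ ⟩
  ((b ∧ x) xor evalForm ρ′ f) xor ((c ∧ x) xor evalForm ρ′ g)
    ∎
  where
  open ≡-Reasoning
  x : Bool
  x = ρ Fin.zero
  ρ′ : Assignment _
  ρ′ = ρ ∘ Fin.suc

value-⊕ : ∀ {n} (ρ : Assignment n) a b → value ρ (a ⊕ b) ≡ value ρ a xor value ρ b
value-⊕ ρ (f , α) (g , β) = trans (cong (_xor (α xor β)) (evalForm-xor ρ f g)) (interchange (evalForm ρ f) _ _ _)

module _ {n : ℕ} where

  head : LinEq (suc n) → Bool
  head (b Vec.∷ _ , _) = b

  tail : LinEq (suc n) → LinEq n
  tail (_ Vec.∷ f , α) = f , α

  extend : Bool → Assignment n → Assignment (suc n)
  extend x ρ Fin.zero    = x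
  extend x ρ (Fin.suc j) = ρ j

  value-extend : ∀ x ρ a → value (extend x ρ) a ≡ (head a ∧ x) xor value ρ (tail a)
  value-extend x ρ (b Vec.∷ f , α) = xor-assoc (b ∧ x) (evalForm ρ f) α

  lift-span : ∀ {G f α} → All (λ a → head a ≡ false) G → (f , α) ∈span map tail G → (false Vec.∷ f , α) ∈span G
  lift-span heads (gen a∈) with ∈-map⁻ tail a∈
  ... | (false Vec.∷ _ , _) , a∈G , refl = gen a∈G
  ... | (true  Vec.∷ _ , _) , a∈G , refl with () ← All.lookup heads a∈G
  lift-span heads (add a b) = add (lift-span heads a) (lift-span heads b)

  eliminate : LinEq (suc n) → LinEq (suc n) → LinEq (suc n)
  eliminate p a@(false Vec.∷ _ , _) = a
  eliminate p a@(true  Vec.∷ _ , _) = a ⊕ p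

  module Pivot (g : Vec Bool n) (β : Bool) where

    p : LinEq (suc n)
    p = true Vec.∷ g , β

    head-eliminate : ∀ a → head (eliminate p a) ≡ false
    head-eliminate (false Vec.∷ _ , _) = refl
    head-eliminate (true  Vec.∷ _ , _) = refl

    eliminate-∈span : ∀ {G a} → p ∈ G → a ∈ G → eliminate p a ∈span G
    eliminate-∈span {a = false Vec.∷ _ , _} p∈G a∈G = gen a∈G
    eliminate-∈span {a = true  Vec.∷ _ , _} p∈G a∈G = add (gen a∈G) (gen p∈G)

    -- extend ρ by the value of the first variable that the pivot equation forces
    value-extend-eliminate : ∀ ρ a → value (extend (value ρ (tail p)) ρ) a ≡ value ρ (tail (eliminate p a))
    value-extend-eliminate ρ a@(false Vec.∷ _ , _) = value-extend (value ρ (tail p)) ρ a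
    value-extend-eliminate ρ a@(true  Vec.∷ _ , _) =
      trans (value-extend (value ρ (tail p)) ρ a)
        (trans (xor-comm (value ρ (tail p)) (value ρ (tail a))) (sym (value-⊕ ρ (tail a) (tail p))))

unsolvable⇒1∈span : ∀ {n} (G : List (LinEq n)) → (∀ ρ → ¬ Solves ρ G) → (replicate n false , true) ∈span G
unsolvable⇒1∈span {zero} G unsat with find-true proj₂ G
... | inj₁ ((Vec.[] , true) , a∈G , _) = gen a∈G
... | inj₂ constants-0 = ⊥-elim (unsat (λ ()) (All.map (λ {a} → constant {a}) constants-0))
  where
  constant : ∀ {a : LinEq zero} → proj₂ a ≡ false → value (λ ()) a ≡ false
  constant {Vec.[] , _} α≡0 = α≡0
unsolvable⇒1∈span {suc n} G unsat with find-true head G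
... | inj₂ heads-0 = lift-span heads-0 (unsolvable⇒1∈span (map tail G) unsat′)
  where
  unsat′ : ∀ ρ → ¬ Solves ρ (map tail G)
  unsat′ ρ sol = unsat (extend false ρ) (All.zipWith (λ {a} → extends a) (heads-0 , map⁻ sol))
    where
    extends : ∀ a → head a ≡ false × value ρ (tail a) ≡ false → value (extend false ρ) a ≡ false
    extends a (h , v) = trans (value-extend false ρ a) (trans (cong (λ b → (b ∧ false) xor value ρ (tail a)) h) v)
... | inj₁ ((true Vec.∷ g , β) , p∈G , _) =
  span-mono (λ a∈G′ → eliminated (∈-map⁻ (eliminate p) a∈G′))
    (lift-span (map⁺ (All.tabulate (λ {a} _ → head-eliminate a))) (unsolvable⇒1∈span (map tail G′) unsat′))
  where
  open Pivot g β
  G′ : List (LinEq (suc n))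
  G′ = map (eliminate p) G
  eliminated : ∀ {a′} → Σ _ (λ a → a ∈ G × a′ ≡ eliminate p a) → a′ ∈span G
  eliminated (a , a∈G , refl) = eliminate-∈span p∈G a∈G
  unsat′ : ∀ ρ → ¬ Solves ρ (map tail G′)
  unsat′ ρ sol = unsat (extend (value ρ (tail p)) ρ)
    (All.map (λ {a} v → trans (value-extend-eliminate ρ a) v) (map⁻ (map⁻ sol)))

module _ {n : ℕ} where

  Selection : List (LinEq n) → Config n → Set
  Selection = Pointwise _∈_

  selection-↭ : ∀ {S₁ S₂ : Config n} {es₂} → S₁ ↭ S₂ → Selection es₂ S₂ →
                Σ (List (LinEq n)) λ es₁ → Selection es₁ S₁ × es₁ ↭ es₂
  selection-↭ ↭.refl sel = _ , sel , ↭.refl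
  selection-↭ (↭.prep C S₁↭S₂) (e∈C ∷ sel) with selection-↭ S₁↭S₂ sel
  ... | es₁ , sel₁ , es₁↭es₂ = _ ∷ es₁ , e∈C ∷ sel₁ , ↭.prep _ es₁↭es₂
  selection-↭ (↭.swap C D S₁↭S₂) (e∈C ∷ e′∈D ∷ sel) with selection-↭ S₁↭S₂ sel
  ... | es₁ , sel₁ , es₁↭es₂ = _ ∷ _ ∷ es₁ , e′∈D ∷ e∈C ∷ sel₁ , ↭.swap _ _ es₁↭es₂
  selection-↭ (↭.trans S₁↭S S↭S₂) sel with selection-↭ S↭S₂ sel
  ... | es , sel′ , es↭es₂ with selection-↭ S₁↭S sel′
  ...   | es₁ , sel₁ , es₁↭es = es₁ , sel₁ , ↭.trans es₁↭es es↭es₂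

  selection-lookup : ∀ {es} {S : Config n} {C} → Selection es S → C ∈ S → Σ (LinEq n) λ e → e ∈ es × e ∈ C
  selection-lookup (e∈C ∷ _)   (here refl) = _ , here refl , e∈C
  selection-lookup (_   ∷ sel) (there C∈S) with selection-lookup sel C∈S
  ... | e , e∈es , e∈C = e , there e∈es , e∈C

  clause-holds : ∀ {ρ e} {C : LinClause n} → e ∈ C → value ρ e ≡ false → T (evalLinClause ρ C)
  clause-holds {ρ} {e} e∈C e-holds = any⁺ (evalEq ρ) (lose e∈C (holds e e-holds))
    where
    holds : ∀ e → value ρ e ≡ false → T (evalEq ρ e)
    holds (f , α) = Equivalence.from T-not-≡

  selection-⊨ : ∀ {S D es ρ} → Derivable S D → Selection es S → Solves ρ es → T (evalLinClause ρ D)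
  selection-⊨ {ρ = ρ} (weaken C∈S C⊨D) sel sol with selection-lookup sel C∈S
  ... | e , e∈es , e∈C = C⊨D ρ (clause-holds e∈C (All.lookup sol e∈es))
  selection-⊨ {D = D} {ρ = ρ} (resolve f A B C₁∈S C₂∈S C₁≈ C₂≈ D≈) sel sol
    with selection-lookup sel C₁∈S | selection-lookup sel C₂∈S
  ... | e₁ , e₁∈es , e₁∈C₁ | e₂ , e₂∈es , e₂∈C₂ =
    resolvent (proj₁ (C₁≈ e₁) e₁∈C₁) (proj₁ (C₂≈ e₂) e₂∈C₂)
              (All.lookup sol e₁∈es) (All.lookup sol e₂∈es)
    where
    resolvent : e₁ ∈ (f , false) ∷ A → e₂ ∈ (f , true) ∷ B →
                value ρ e₁ ≡ false → value ρ e₂ ≡ false → T (evalLinClause ρ D)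
    resolvent (there e₁∈A) _            e₁-holds _ = clause-holds (proj₂ (D≈ e₁) (∈-++⁺ˡ e₁∈A)) e₁-holds
    resolvent (here _)     (there e₂∈B) _ e₂-holds = clause-holds (proj₂ (D≈ e₂) (∈-++⁺ʳ A e₂∈B)) e₂-holds
    resolvent (here refl)  (here refl)  f≡0 f≡1 with evalForm ρ f
    resolvent (here refl)  (here refl)  ()  f≡1 | true
    resolvent (here refl)  (here refl)  f≡0 ()  | false

  selectionPoly : List (LinEq n) → Poly n
  selectionPoly = ∏ indicatorPoly

  selectionPoly-↭ : ∀ {es es′} → es ↭ es′ → selectionPoly es ≋ selectionPoly es′
  selectionPoly-↭ {es} {es′} es↭es′ = begin
    ∏ indicatorPoly es                          ≡⟨ foldr-map _*P_ indicatorPoly onePoly es ⟨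
    foldr _*P_ onePoly (map indicatorPoly es)   ≈⟨ foldr-commMonoid P.setoid P.*-isCommutativeMonoid
                                                     (↭⇒↭ₛ′ P.isEquivalence (↭ₚ.map⁺ indicatorPoly es↭es′)) ⟩
    foldr _*P_ onePoly (map indicatorPoly es′)  ≡⟨ foldr-map _*P_ indicatorPoly onePoly es′ ⟩
    ∏ indicatorPoly es′                         ∎
    where open import Relation.Binary.Reasoning.Setoid (P.setoid {n})

length≤space : ∀ {n} {φ : CNF n} {S} (R : Run φ S) → length S ≤ space R
length≤space (done _)           = ℕ.≤-refl
length≤space {S = S} (step _ R) = ℕ.m≤m⊔n (length S) (space R)

-- Simulating a refutation

module Simulation {n : ℕ} (φ : CNF n) (d : ℕ) (⊢0 : Derivability.⊢_ φ d []) where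

  open Derivability φ d

  ⊢-selectionPoly*affinePoly : ∀ {es e} → e ∈ es → suc (length es) ≤ d → ⊢ selectionPoly es *P affinePoly e
  ⊢-selectionPoly*affinePoly {es} {e@(f , α)} e∈es es<d with ∈-∃++ e∈es
  ... | ys , zs , refl = ⊢-resp-≋ (P.sym Q·e≈∑) (⊢-∑ ⊢0 n _ R·b≤d ⊢R·b)
    where
    rest : List (LinEq n)
    rest = ys ++ zs
    R : Poly n
    R = selectionPoly rest
    es↭e∷rest : es ↭ e ∷ rest
    es↭e∷rest = ↭ₚ.shift e ys zs
    rest+2≤d : length rest + 2 ≤ d
    rest+2≤d = subst (_≤ d) (trans (cong suc (↭ₚ.↭-length es↭e∷rest)) (ℕ.+-comm 2 (length rest))) es<d
    Q·e≈∑ : (selectionPoly es *P affinePoly e) ≋ ∑ n (λ j → R *P when (Vec.lookup f j) (boolAx j))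
    Q·e≈∑ = begin
      selectionPoly es *P affinePoly e                    ≈⟨ P.*-congʳ {x = affinePoly e} (selectionPoly-↭ es↭e∷rest) ⟩
      (indicatorPoly e *P R) *P affinePoly e              ≈⟨ P.*-congʳ {x = affinePoly e} (P.*-comm (indicatorPoly e) R) ⟩
      (R *P indicatorPoly e) *P affinePoly e              ≈⟨ P.*-assoc R (indicatorPoly e) (affinePoly e) ⟩
      R *P (indicatorPoly e *P affinePoly e)              ≈⟨ P.*-congˡ {x = R} (indicatorPoly*affinePoly e) ⟩
      R *P booleanSum f                                   ≈⟨ *P-distribˡ-∑ R n _ ⟩
      ∑ n (λ j → R *P when (Vec.lookup f j) (boolAx j))  ∎
      where open import Relation.Binary.Reasoning.Setoid (P.setoid {n})
    R·b≤d : ∀ j → MonomialsDegLe (R *P when (Vec.lookup f j) (boolAx j)) d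
    R·b≤d j = MonomialsDegLe-mono rest+2≤d (MonomialsDegLe-*P (MonomialsDegLe-∏ indicatorPoly-affine rest)
                                              (MonomialsDegLe-when (Vec.lookup f j) (MonomialsDegLe-boolAx j)))
    ⊢R·b : ∀ j → ⊢ R *P when (Vec.lookup f j) (boolAx j)
    ⊢R·b j with Vec.lookup f j
    ... | true  = ⊢-∏*P indicatorPoly-affine rest (MonomialsDegLe-boolAx j) rest+2≤d
                    (⊢-boolAx (ℕ.≤-trans (ℕ.m≤n+m 2 (length rest)) rest+2≤d) j)
    ... | false = ⊢-resp-≋ (P.sym (P.zeroʳ R)) ⊢0

  SelectionsDerivable : Config n → Set
  SelectionsDerivable S = ∀ {es} → Selection es S → ⊢ selectionPoly es

  selectionsDerivable-final : ∀ {S} → [] ∈ S → SelectionsDerivable S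
  selectionsDerivable-final []∈S sel with selection-lookup sel []∈S
  ... | _ , _ , ()

  selectionsDerivable-↭ : ∀ {S₁ S₂} → S₁ ↭ S₂ → SelectionsDerivable S₁ → SelectionsDerivable S₂
  selectionsDerivable-↭ S₁↭S₂ sd sel₂ with selection-↭ S₁↭S₂ sel₂
  ... | _ , sel₁ , es₁↭es₂ = ⊢-resp-≋ (selectionPoly-↭ es₁↭es₂) (sd sel₁)

  selectionsDerivable-erase : ∀ {S C} → length (C ∷ S) ≤ d → SelectionsDerivable S → SelectionsDerivable (C ∷ S)
  selectionsDerivable-erase C∷S≤d sd {e ∷ es} (_ ∷ sel) =
    ⊢-affine*P (indicatorPoly-affine e) (MonomialsDegLe-∏ indicatorPoly-affine es)
      (subst (λ k → suc k ≤ d) (sym (Pointwise-length sel)) C∷S≤d) (sd sel)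

  selectionsDerivable-download : ∀ {S C} → C ∈ φ → length (linClause C ∷ S) + length C ≤ d →
                                 SelectionsDerivable (linClause C ∷ S) → SelectionsDerivable S
  selectionsDerivable-download {S} {C} C∈φ bound sd {es} sel =
    ⊢-cut-literals C (MonomialsDegLe-∏ indicatorPoly-affine es) C+es≤d es<d
      (λ l∈C → sd (∈-map⁺ linLit l∈C ∷ sel))
      (⊢-∏*P indicatorPoly-affine es (MonomialsDegLe-∏ arithLit-affine C) es+C≤d
        (⊢-axiom C∈φ (ℕ.≤-trans (ℕ.m≤n+m (length C) (length es)) es+C≤d)))
    where
    1+es+C≤d : suc (length es + length C) ≤ d
    1+es+C≤d = subst (λ k → suc (k + length C) ≤ d) (sym (Pointwise-length sel)) bound
    es+C≤d : length es + length C ≤ d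
    es+C≤d = ℕ.≤-trans (ℕ.n≤1+n _) 1+es+C≤d
    C+es≤d : length C + length es ≤ d
    C+es≤d = subst (_≤ d) (ℕ.+-comm (length es) (length C)) es+C≤d
    es<d : suc (length es) ≤ d
    es<d = ℕ.≤-trans (s≤s (ℕ.m≤m+n (length es) (length C))) 1+es+C≤d

  selectionsDerivable-infer : ∀ {S D} → Derivable S D → suc (length (D ∷ S)) ≤ d →
                              SelectionsDerivable (D ∷ S) → SelectionsDerivable S
  selectionsDerivable-infer {S} {D} S⊢D bound sd {es} sel =
    ⊢-resp-≋ Q·1≈Q (⊢Q·span (unsolvable⇒1∈span (map negate D ++ es) unsolvable))
    where
    Q : Poly n
    Q = selectionPoly es
    es<d : suc (length es) ≤ d
    es<d = ℕ.≤-trans (ℕ.n≤1+n _) (subst (λ k → suc (suc k) ≤ d) (sym (Pointwise-length sel)) bound)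
    Q·a≤d : ∀ a → MonomialsDegLe (Q *P affinePoly a) d
    Q·a≤d a = MonomialsDegLe-mono (subst (_≤ d) (ℕ.+-comm 1 (length es)) es<d)
                (MonomialsDegLe-*P (MonomialsDegLe-∏ indicatorPoly-affine es) (MonomialsDegLe-affine (affinePoly-affine a)))
    ⊢Q·gen : ∀ {a} → a ∈ map negate D ++ es → ⊢ Q *P affinePoly a
    ⊢Q·gen a∈ with ∈-++⁻ (map negate D) a∈
    ... | inj₂ a∈es = ⊢-selectionPoly*affinePoly a∈es es<d
    ... | inj₁ a∈¬D with ∈-map⁻ negate a∈¬D
    ...   | e , e∈D , refl = ⊢-resp-≋ (P.*-comm (indicatorPoly e) Q) (sd (e∈D ∷ sel))
    ⊢Q·span : ∀ {a} → a ∈span map negate D ++ es → ⊢ Q *P affinePoly a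
    ⊢Q·span (gen a∈) = ⊢Q·gen a∈
    ⊢Q·span (add {a} {b} a∈ b∈) =
      ⊢-resp-≋ (P.sym (P.trans (P.*-congˡ {x = Q} (affinePoly-⊕ a b)) (P.distribˡ Q _ _)))
        (⊢-+P (DegLe-from-monomials (++⁺ (Q·a≤d a) (Q·a≤d b))) (⊢Q·span a∈) (⊢Q·span b∈))
    Q·1≈Q : (Q *P affinePoly (replicate n false , true)) ≋ Q
    Q·1≈Q = P.trans (P.*-congˡ {x = Q} affinePoly-one) (P.*-identityʳ Q)
    unsolvable : ∀ ρ → ¬ Solves ρ (map negate D ++ es)
    unsolvable ρ sol with ++⁻ (map negate D) sol
    ... | D-fails , es-holds = All¬⇒¬Any (All.map (λ {e} → fails e) (map⁻ D-fails))
                                 (any⁻ (evalEq ρ) D (selection-⊨ S⊢D sel es-holds))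
      where
      fails : ∀ e → value ρ (negate e) ≡ false → ¬ T (evalEq ρ e)
      fails (f , α) v = subst T (trans (not-distribʳ-xor (evalForm ρ f) α) v)

  selectionsDerivable-run : ∀ {r} → IsRCNF r φ → ∀ {S} (R : Run φ S) → space R + r + 1 ≤ d → SelectionsDerivable S
  selectionsDerivable-run φ-r (done []∈S) _ = selectionsDerivable-final []∈S
  selectionsDerivable-run {r} φ-r {S} (step {S′ = S′} st R) S+r+1≤d = go st
    where
    open ℕ.≤-Reasoning
    R+r+1≤d : space R + r + 1 ≤ d
    R+r+1≤d = ℕ.≤-trans (ℕ.+-monoˡ-≤ 1 (ℕ.+-monoˡ-≤ r (ℕ.m≤n⊔m (length S) (space R)))) S+r+1≤d
    S′+r+1≤d : length S′ + r + 1 ≤ d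
    S′+r+1≤d = ℕ.≤-trans (ℕ.+-monoˡ-≤ 1 (ℕ.+-monoˡ-≤ r (length≤space R))) R+r+1≤d
    IH : SelectionsDerivable S′
    IH = selectionsDerivable-run φ-r R R+r+1≤d
    go : Step φ S S′ → SelectionsDerivable S
    go (download {C} C∈φ S′↭) = selectionsDerivable-download C∈φ
      (subst (λ k → k + length C ≤ d) (↭ₚ.↭-length S′↭) S′+C≤d) (selectionsDerivable-↭ S′↭ IH)
      where
      S′+C≤d : length S′ + length C ≤ d
      S′+C≤d = begin
        length S′ + length C  ≤⟨ ℕ.+-monoʳ-≤ (length S′) (proj₂ (All.lookup φ-r C∈φ)) ⟩
        length S′ + r         ≤⟨ ℕ.m≤m+n _ 1 ⟩
        length S′ + r + 1     ≤⟨ S′+r+1≤d ⟩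
        d                     ∎
    go (erase S↭) = selectionsDerivable-↭ (↭-sym S↭)
      (selectionsDerivable-erase (subst (_≤ d) (↭ₚ.↭-length S↭) S≤d) IH)
      where
      S≤d : length S ≤ d
      S≤d = begin
        length S                     ≤⟨ ℕ.m≤m⊔n (length S) (space R) ⟩
        space (step st R)            ≤⟨ ℕ.m≤m+n _ r ⟩
        space (step st R) + r        ≤⟨ ℕ.m≤m+n _ 1 ⟩
        space (step st R) + r + 1    ≤⟨ S+r+1≤d ⟩
        d                            ∎
    go (infer S⊢D S′↭) = selectionsDerivable-infer S⊢D
      (subst (λ k → suc k ≤ d) (↭ₚ.↭-length S′↭) S′<d) (selectionsDerivable-↭ S′↭ IH)
      where
      S′<d : suc (length S′) ≤ d
      S′<d = begin
        suc (length S′)    ≡⟨ ℕ.+-comm 1 (length S′) ⟩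
        length S′ + 1      ≤⟨ ℕ.+-monoˡ-≤ 1 (ℕ.m≤m+n _ r) ⟩
        length S′ + r + 1  ≤⟨ S′+r+1≤d ⟩
        d                  ∎

corollary4p9 : ∀ {n} (r : ℕ) (φ : CNF n) → IsRCNF r φ → Unsatisfiable φ →
                 (π : ResXorRefutation φ) → PCRefutation φ (space π + r + 1)
corollary4p9 r φ φ-r φ-unsat π =
  let p , derivation , p≋1 = selectionsDerivable-run φ-r π ℕ.≤-refl [] in p , derivation , coeff-≡ p≋1
  where
  d : ℕ
  d = space π + r + 1
  ⊢0 : Derivability.⊢_ φ d []
  ⊢0 = zero-derivable φ φ-r φ-unsat (ℕ.≤-trans (ℕ.m≤n+m r (space π)) (ℕ.m≤m+n _ 1))
  open Simulation φ d ⊢0
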